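{- The permutation statistic $(a-cb)+(b-ca)+(c-ba)+[b-a)$ is Mahonian; that is, for every $n\ge1$ and every integer $k$, the number of $\pi\in\mathfrak S_n$ with $((a-cb)+(b-ca)+(c-ba)+[b-a))\,\pi=k$ equals the number of $\pi\in\mathfrak S_n$ with $\mathrm{inv}\,\pi=k$.
   Context: $\mathfrak S_n$ is the set of permutations $\pi=\pi_1\cdots\pi_n$ of $\{1,\dots,n\}$; $\mathrm{inv}\,\pi=\#\{(i,j):1\le i<j\le n,\ \pi_i>\pi_j\}$. Vincular patterns are words over letters $a<b<c$ possibly containing dashes and a leading "[" or trailing "]". An occurrence of a pattern $p=p_1\cdots p_k$ (letters, ignoring dashes and brackets) in $\pi$ is a sequence of positions $i_1<\dots<i_k$ such that $\pi_{i_1}\cdots\pi_{i_k}$ is order-isomorphic to $p_1\cdots p_k$, with $i_{r+1}=i_r+1$ whenever the $r$-th and $(r+1)$-st letters are not separated by a dash, $i_1=1$ if the pattern begins with "[", and $i_k=n$ if it ends with "]". $(\sigma+\tau+\cdots)\,\pi$ is the total number of occurrences of the listed patterns. E.g. $(b-ca)\,\pi=\#\{(i,j):i<j<n,\ \pi_{j+1}<\pi_i<\pi_j\}$ and $[b-a)\,\pi=\#\{j>1:\pi_j<\pi_1\}$. -}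

module Defs where

open import Data.Nat using (ℕ; zero; suc; _+_; _<_; _<?_)
open import Data.Fin using (Fin; toℕ)
open import Data.Vec using (Vec; []; _∷_; lookup)
open import Data.List using (List; []; _∷_; map; concatMap; length; filter; upTo; allFin; cartesianProduct)
open import Data.List.Relation.Unary.Unique.Propositional using (Unique)
open import Data.Product using (_×_; _,_)
open import Relation.Nullary.Decidable using (_×-dec_)
import Data.Fin as F
open import Data.Vec using (toList)
open import Data.Integer using (ℤ; +_)
import Data.Integer as ℤ
open import Relation.Nullary.Decidable using (Dec)
import Data.List.Relation.Unary.Unique.DecPropositional as UD

words : (m len : ℕ) → List (Vec (Fin m) len)
words m zero = [] ∷ []
words m (suc len) = concatMap (λ x → map (x ∷_) (words m len)) (allFin m)

-- A permutation π ∈ 𝔖ₙ is represented as the word π₁⋯πₙ with distinct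
-- letters from Fin n (letter x stands for the value x+1; only the relative
-- order matters for all statistics below).
IsPerm : ∀ {n} → Vec (Fin n) n → Set
IsPerm π = Unique (toList π)

isPerm? : ∀ {n} (π : Vec (Fin n) n) → Dec (IsPerm π)
isPerm? π = UD.unique? F._≟_ (toList π)

-- 0-based natural-number indexing helper: value at position p (0 if out of range).
at : ∀ {m n} → Vec (Fin m) n → ℕ → ℕ
at [] _ = 0
at (x ∷ _) zero = toℕ x
at (_ ∷ xs) (suc p) = at xs p

natPairs : ℕ → List (ℕ × ℕ)
natPairs n = cartesianProduct (upTo n) (upTo n)

inv : ∀ {n} → Vec (Fin n) n → ℕ
inv {n} π = length (filter (λ { (i , j) → (i <? j) ×-dec (at π j <? at π i) }) (natPairs n))

acb : ∀ {n} → Vec (Fin n) n → ℕ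
acb {n} π = length (filter (λ { (i , j) → (i <? j) ×-dec ((suc j <? n) ×-dec
  ((at π i <? at π (suc j)) ×-dec (at π (suc j) <? at π j))) }) (natPairs n))

bca : ∀ {n} → Vec (Fin n) n → ℕ
bca {n} π = length (filter (λ { (i , j) → (i <? j) ×-dec ((suc j <? n) ×-dec
  ((at π (suc j) <? at π i) ×-dec (at π i <? at π j))) }) (natPairs n))

cba : ∀ {n} → Vec (Fin n) n → ℕ
cba {n} π = length (filter (λ { (i , j) → (i <? j) ×-dec ((suc j <? n) ×-dec
  ((at π (suc j) <? at π j) ×-dec (at π j <? at π i))) }) (natPairs n))

ba[ : ∀ {n} → Vec (Fin n) n → ℕ
ba[ {n} π = length (filter (λ j → (0 <? j) ×-dec (at π j <? at π 0)) (upTo n))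

stat : ∀ {n} → Vec (Fin n) n → ℕ
stat π = acb π + bca π + cba π + ba[ π

count : (n : ℕ) → (Vec (Fin n) n → ℕ) → ℤ → ℕ
count n f k = length (filter (λ π → isPerm? π ×-dec (+ f π ℤ.≟ k)) (words n n))

-- Write π = x σ. For a descent πⱼ > πⱼ₊₁ of π, every earlier position i gives exactly one
-- occurrence of a-cb, b-ca or c-ba, according to where πᵢ lies relative to the descent, and no
-- occurrence arises without a descent; so the three patterns together count maj σ. As [b-a)
-- counts the letters of σ below x, stat π = #{y ∈ σ : y < x} + maj σ, whereas
-- inv π = #{y ∈ σ : y < x} + inv σ. It therefore suffices that maj and inv are equidistributed
-- over the arrangements of any set of distinct letters (MacMahon), which holds because inserting
-- a new largest letter into the |σ| + 1 slots of σ raises each of them by 0, 1, …, |σ| in some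
-- order (for maj this is Carlitz's insertion argument).

module Submission where

import Algebra.Properties.CommutativeSemigroup
open import Data.Bool using (if_then_else_)
open import Data.Fin using (Fin; toℕ; fromℕ<)
open import Data.Fin.Properties using (toℕ-injective; toℕ<n; toℕ-fromℕ<)
open import Data.Integer using (ℤ)
import Data.Integer as ℤ
open import Data.List
  using (List; []; _∷_; _++_; [_]; map; concatMap; length; filter; applyUpTo; upTo; downFrom; allFin;
         cartesianProduct; cartesianProductWith)
open import Data.List.Properties
  using (map-∘; map-++; map-cong; map-injective; length-map; length-++; length-downFrom; ++-assoc; ∷-injectiveˡ;
         ∷-injectiveʳ; concatMap-++; concatMap-map; map-concatMap; concatMap-cong; filter-++; filter-accept; filter-reject)
open import Data.List.Membership.Propositional using (_∈_; find; lose)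
open import Data.List.Membership.Propositional.Properties
  using (∈-map⁺; ∈-map⁻; ∈-concatMap⁺; ∈-concatMap⁻; ∈-filter⁺; ∈-filter⁻; ∈-allFin; ∈-downFrom⁺; ∈-downFrom⁻)
open import Data.List.Membership.Propositional.Properties.WithK using (unique∧set⇒bag)
open import Data.List.Relation.Binary.BagAndSetEquality using (∼bag⇒↭)
open import Data.List.Relation.Binary.Permutation.Propositional
  using (_↭_; prep; swap; ↭-sym; ↭-reflexive; ↭⇒↭ₛ; module PermutationReasoning)
  renaming (refl to ↭-refl; trans to ↭-trans)
open import Data.List.Relation.Binary.Permutation.Propositional.Properties
  using (shift; ++-comm; map⁺; ++⁺; ++⁺ˡ; ++⁺ʳ; All-resp-↭; ∈-resp-↭; ↭-length; filter-↭)
  renaming (++-assoc to ↭-++-assoc)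
import Data.List.Relation.Binary.Permutation.Setoid.Properties as ↭ₛ
open import Data.List.Relation.Unary.All using (All; []; _∷_)
import Data.List.Relation.Unary.All as All
import Data.List.Relation.Unary.All.Properties as All
open import Data.List.Relation.Unary.AllPairs using (AllPairs; []; _∷_)
import Data.List.Relation.Unary.AllPairs as AllPairs
open import Data.List.Relation.Unary.AllPairs.Properties using (applyDownFrom⁺₁)
open import Data.List.Relation.Unary.Any using (here; there)
open import Data.List.Relation.Unary.Unique.Propositional using (Unique)
import Data.List.Relation.Unary.Unique.Propositional.Properties as Unique
open import Data.Nat using (ℕ; zero; suc; _+_; _<_; _>_; _≥_; _<?_; z≤n; s≤s)
open import Data.Nat.Properties
  using (+-comm; +-assoc; +-suc; +-identityʳ; +-commutativeSemigroup; <-asym; <-trans; <-cmp; n<1+n; <⇒≢; suc-injective)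
open import Data.Nat.Solver using (module +-*-Solver)
open import Data.Product using (_×_; _,_; proj₁; proj₂; ∃)
open import Data.Sum using (_⊎_; inj₁; inj₂)
open import Data.Vec using (Vec; []; _∷_; toList)
open import Data.Vec.Properties using (toList-injective; length-toList; ∷-injective; cast-is-id)
open import Function using (_∘_; id)
open import Function.Bundles using (mk⇔)
open import Relation.Binary.Definitions using (tri<; tri≈; tri>)
open import Relation.Binary.PropositionalEquality
  using (_≡_; _≢_; refl; sym; trans; cong; cong₂; subst; setoid; module ≡-Reasoning)
open import Relation.Nullary using (Dec; yes; no; ¬_; does; ¬?; contradiction; _×-dec_)
open import Relation.Unary using (Decidable)

open +-*-Solver using (solve; _:+_; _:=_; con)
open Algebra.Properties.CommutativeSemigroup +-commutativeSemigroup using (x∙yz≈y∙xz; interchange)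

-- Defined through `does` so that indicators of guards such as 0 <? 0 or suc i <? suc j compute;
-- this makes the reindexing of the sums over positions below definitional.
𝟙 : ∀ {a} {A : Set a} → Dec A → ℕ
𝟙 d = if does d then 1 else 0

module _ {a} {A : Set a} where

  𝟙-yes : A → (d : Dec A) → 𝟙 d ≡ 1
  𝟙-yes _ (yes _) = refl
  𝟙-yes x (no ¬x) = contradiction x ¬x

  𝟙-no : ¬ A → (d : Dec A) → 𝟙 d ≡ 0
  𝟙-no ¬x (yes x) = contradiction x ¬x
  𝟙-no _  (no _)  = refl

  𝟙-+-𝟙-¬ : ∀ (d : Dec A) m n → suc (m + n) ≡ 𝟙 d + m + (𝟙 (¬? d) + n)
  𝟙-+-𝟙-¬ (yes _) m n = refl
  𝟙-+-𝟙-¬ (no _)  m n = sym (+-suc m n)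

𝟙<-asym : ∀ {x y} → x < y → 𝟙 (y <? x) ≡ 0
𝟙<-asym {x} {y} x<y = 𝟙-no (<-asym x<y) (y <? x)

module _ {A B : Set} where

  𝟙-×-yes : A → (a : Dec A) (b : Dec B) → 𝟙 (a ×-dec b) ≡ 𝟙 b
  𝟙-×-yes _ (yes _) b = refl
  𝟙-×-yes x (no ¬x) b = contradiction x ¬x

𝟙-<-total : ∀ x y → x ≢ y → 𝟙 (x <? y) + 𝟙 (y <? x) ≡ 1
𝟙-<-total x y x≢y with <-cmp x y
... | tri< x<y _ y≮x rewrite 𝟙-yes x<y (x <? y) | 𝟙-no y≮x (y <? x) = refl
... | tri≈ _ x≡y _   = contradiction x≡y x≢y
... | tri> x≮y _ y<x rewrite 𝟙-no x≮y (x <? y) | 𝟙-yes y<x (y <? x) = refl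

𝟙-×-guard : ∀ {G C₁ C₂ C₃ D : Set} (g : Dec G) (c₁ : Dec C₁) (c₂ : Dec C₂) (c₃ : Dec C₃) (d : Dec D) →
  (G → 𝟙 c₁ + 𝟙 c₂ + 𝟙 c₃ ≡ 𝟙 d) → 𝟙 (g ×-dec c₁) + 𝟙 (g ×-dec c₂) + 𝟙 (g ×-dec c₃) ≡ 𝟙 (g ×-dec d)
𝟙-×-guard (yes g) _ _ _ _ split = split g
𝟙-×-guard (no _)  _ _ _ _ _     = refl

module _ {A B : Set} where

  map-cong-∈ : ∀ (f g : A → B) xs → (∀ {x} → x ∈ xs → f x ≡ g x) → map f xs ≡ map g xs
  map-cong-∈ f g []       f≡g = refl
  map-cong-∈ f g (x ∷ xs) f≡g = cong₂ _∷_ (f≡g (here refl)) (map-cong-∈ f g xs (f≡g ∘ there))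

  concatMap-cong-↭ : ∀ (f g : A → List B) xs → (∀ {x} → x ∈ xs → f x ↭ g x) → concatMap f xs ↭ concatMap g xs
  concatMap-cong-↭ f g []       f↭g = ↭-refl
  concatMap-cong-↭ f g (x ∷ xs) f↭g = ++⁺ (f↭g (here refl)) (concatMap-cong-↭ f g xs (f↭g ∘ there))

  concatMap⁺ : ∀ (f : A → List B) {xs ys} → xs ↭ ys → concatMap f xs ↭ concatMap f ys
  concatMap⁺ f ↭-refl        = ↭-refl
  concatMap⁺ f (prep x p)    = ++⁺ˡ (f x) (concatMap⁺ f p)
  concatMap⁺ f {x ∷ y ∷ xs} (swap x y p) =
    ↭-trans (↭-sym (↭-++-assoc (f x) (f y) (concatMap f xs)))
    (↭-trans (++⁺ʳ (concatMap f xs) (++-comm (f x) (f y)))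
    (↭-trans (↭-++-assoc (f y) (f x) (concatMap f xs))
             (++⁺ˡ (f y) (++⁺ˡ (f x) (concatMap⁺ f p)))))
  concatMap⁺ f (↭-trans p q) = ↭-trans (concatMap⁺ f p) (concatMap⁺ f q)

  concatMap-∷-↭ : ∀ (h : A → B) (g : A → List B) xs →
    concatMap (λ x → h x ∷ g x) xs ↭ map h xs ++ concatMap g xs
  concatMap-∷-↭ h g []       = ↭-refl
  concatMap-∷-↭ h g (x ∷ xs) = prep (h x) (↭-trans (++⁺ˡ (g x) (concatMap-∷-↭ h g xs))
    (↭-trans (↭-sym (↭-++-assoc (g x) (map h xs) (concatMap g xs)))
    (↭-trans (++⁺ʳ (concatMap g xs) (++-comm (g x) (map h xs)))
             (↭-++-assoc (map h xs) (g x) (concatMap g xs)))))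

Unique-resp-↭ : ∀ {A : Set} {xs ys : List A} → xs ↭ ys → Unique xs → Unique ys
Unique-resp-↭ {A} xs↭ys = ↭ₛ.Unique-resp-↭ (setoid A) (↭⇒↭ₛ xs↭ys)

concatMap-concatMap : ∀ {A B C : Set} (g : B → List C) (h : A → List B) xs →
  concatMap g (concatMap h xs) ≡ concatMap (concatMap g ∘ h) xs
concatMap-concatMap g h []       = refl
concatMap-concatMap g h (x ∷ xs) =
  trans (concatMap-++ g (h x) (concatMap h xs)) (cong (concatMap g (h x) ++_) (concatMap-concatMap g h xs))

length-filter-∷ : ∀ {A : Set} {p} {P : A → Set p} (P? : Decidable P) x xs →
  length (filter P? (x ∷ xs)) ≡ 𝟙 (P? x) + length (filter P? xs)
length-filter-∷ P? x xs with P? x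
... | yes _ = refl
... | no _  = refl

module _ {A : Set} {p} {P : A → Set p} where

  length-filter-++ : ∀ (P? : Decidable P) xs ys →
    length (filter P? (xs ++ ys)) ≡ length (filter P? xs) + length (filter P? ys)
  length-filter-++ P? xs ys = trans (cong length (filter-++ P? xs ys)) (length-++ (filter P? xs))

  length-filter-map : ∀ {B : Set} (P? : Decidable P) (h : B → A) xs →
    length (filter P? (map h xs)) ≡ length (filter (P? ∘ h) xs)
  length-filter-map P? h []       = refl
  length-filter-map P? h (x ∷ xs) = begin
    length (filter P? (map h (x ∷ xs)))        ≡⟨ length-filter-∷ P? (h x) _ ⟩
    𝟙 (P? (h x)) + length (filter P? (map h xs)) ≡⟨ cong (_ +_) (length-filter-map P? h xs) ⟩
    𝟙 (P? (h x)) + length (filter (P? ∘ h) xs)   ≡⟨ length-filter-∷ (P? ∘ h) x xs ⟨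
    length (filter (P? ∘ h) (x ∷ xs))          ∎
    where open ≡-Reasoning

filter-×-dec : ∀ {A : Set} {p q} {P : A → Set p} {Q : A → Set q} (P? : Decidable P) (Q? : Decidable Q) xs →
  filter (λ x → P? x ×-dec Q? x) xs ≡ filter Q? (filter P? xs)
filter-×-dec P? Q? []       = refl
filter-×-dec {P = P} {Q} P? Q? (x ∷ xs) = by-cases (P? x) (Q? x)
  where
  open ≡-Reasoning
  R? = λ x → P? x ×-dec Q? x
  by-cases : Dec (P x) → Dec (Q x) → filter R? (x ∷ xs) ≡ filter Q? (filter P? (x ∷ xs))
  by-cases (yes px) (yes qx) = begin
    filter R? (x ∷ xs)                 ≡⟨ filter-accept R? (px , qx) ⟩
    x ∷ filter R? xs                   ≡⟨ cong (x ∷_) (filter-×-dec P? Q? xs) ⟩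
    x ∷ filter Q? (filter P? xs)       ≡⟨ filter-accept Q? qx ⟨
    filter Q? (x ∷ filter P? xs)       ≡⟨ cong (filter Q?) (filter-accept P? px) ⟨
    filter Q? (filter P? (x ∷ xs))     ∎
  by-cases (yes px) (no ¬qx) = begin
    filter R? (x ∷ xs)                 ≡⟨ filter-reject R? (¬qx ∘ proj₂) ⟩
    filter R? xs                       ≡⟨ filter-×-dec P? Q? xs ⟩
    filter Q? (filter P? xs)           ≡⟨ filter-reject Q? ¬qx ⟨
    filter Q? (x ∷ filter P? xs)       ≡⟨ cong (filter Q?) (filter-accept P? px) ⟨
    filter Q? (filter P? (x ∷ xs))     ∎
  by-cases (no ¬px) _ = begin
    filter R? (x ∷ xs)                 ≡⟨ filter-reject R? (¬px ∘ proj₁) ⟩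
    filter R? xs                       ≡⟨ filter-×-dec P? Q? xs ⟩
    filter Q? (filter P? xs)           ≡⟨ cong (filter Q?) (filter-reject P? ¬px) ⟨
    filter Q? (filter P? (x ∷ xs))     ∎

interval : ℕ → ℕ → List ℕ
interval s zero    = []
interval s (suc c) = s ∷ interval (suc s) c

interval-suc : ∀ s c → interval (suc s) c ≡ map suc (interval s c)
interval-suc s zero    = refl
interval-suc s (suc c) = cong (suc s ∷_) (interval-suc (suc s) c)

interval-++ : ∀ s a b → interval s a ++ interval (s + a) b ≡ interval s (a + b)
interval-++ s zero    b = cong (λ t → interval t b) (+-identityʳ s)
interval-++ s (suc a) b =
  cong (s ∷_) (trans (cong (λ t → interval (suc s) a ++ interval t b) (+-suc s a)) (interval-++ (suc s) a b))

interval-snoc : ∀ s c → interval s (suc c) ≡ interval s c ++ [ s + c ]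
interval-snoc s c = trans (cong (interval s) (+-comm 1 c)) (sym (interval-++ s c 1))

map-interval-suc : ∀ {B : Set} (g : ℕ → B) s c → map g (interval (suc s) c) ≡ map (λ i → g (suc i)) (interval s c)
map-interval-suc g s c = trans (cong (map g) (interval-suc s c)) (sym (map-∘ (interval s c)))

insert : ∀ {A : Set} → ℕ → A → List A → List A
insert zero    M σ       = M ∷ σ
insert (suc p) M []      = M ∷ []
insert (suc p) M (s ∷ τ) = s ∷ insert p M τ

slots : ∀ {A : Set} → List A → List ℕ
slots σ = interval 0 (suc (length σ))

module Word where

  below : ℕ → List ℕ → ℕ
  below x []      = 0
  below x (y ∷ w) = 𝟙 (y <? x) + below x w

  descentAtHead : ℕ → List ℕ → ℕ
  descentAtHead x []      = 0
  descentAtHead x (y ∷ _) = 𝟙 (y <? x)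

  ascentAtHead : ℕ → List ℕ → ℕ
  ascentAtHead x []      = 0
  ascentAtHead x (y ∷ _) = 𝟙 (¬? (y <? x))

  des : List ℕ → ℕ
  des []      = 0
  des (x ∷ w) = descentAtHead x w + des w

  asc : List ℕ → ℕ
  asc []      = 0
  asc (x ∷ w) = ascentAtHead x w + asc w

  maj : List ℕ → ℕ
  maj []      = 0
  maj (x ∷ w) = des (x ∷ w) + maj w

  inv : List ℕ → ℕ
  inv []      = 0
  inv (x ∷ w) = below x w + inv w

  stat : List ℕ → ℕ
  stat []      = 0
  stat (x ∷ w) = below x w + maj w

  length≡1+des+asc : ∀ x w → length (x ∷ w) ≡ suc (des (x ∷ w) + asc (x ∷ w))
  length≡1+des+asc x []      = refl
  length≡1+des+asc x (y ∷ w) =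
    cong suc (trans (length≡1+des+asc y w) (𝟙-+-𝟙-¬ (y <? x) (des (y ∷ w)) (asc (y ∷ w))))

open Word hiding (inv; stat)

-- Inserting a new maximum

ShiftsUnderMaxInsertion : (List ℕ → ℕ) → Set
ShiftsUnderMaxInsertion f =
  ∀ M σ → All (_< M) σ → map (λ p → f (insert p M σ)) (slots σ) ↭ map (f σ +_) (slots σ)

map-+-interval-split : ∀ m d a →
  map (m +_) (interval 0 (2 + d + a)) ≡ m ∷ map (m +_) (interval 1 d) ++ suc (d + m) ∷ map (m +_) (interval (2 + d) a)
map-+-interval-split m d a = begin
  map (m +_) (interval 0 (2 + d + a))
    ≡⟨ cong (λ z → map (m +_) (interval 0 z)) (sym (+-suc (suc d) a)) ⟩
  map (m +_) (interval 0 (suc d + suc a))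
    ≡⟨ cong (map (m +_)) (sym (interval-++ 0 (suc d) (suc a))) ⟩
  map (m +_) (interval 0 (suc d) ++ interval (suc d) (suc a))
    ≡⟨ map-++ (m +_) (interval 0 (suc d)) (interval (suc d) (suc a)) ⟩
  (m + 0) ∷ A₁ ++ (m + suc d) ∷ A₂
    ≡⟨ cong₂ (λ x y → x ∷ A₁ ++ y ∷ A₂) (+-identityʳ m) (trans (+-suc m d) (cong suc (+-comm m d))) ⟩
  m ∷ A₁ ++ suc (d + m) ∷ A₂ ∎
  where
  open ≡-Reasoning
  A₁ = map (m +_) (interval 1 d)
  A₂ = map (m +_) (interval (2 + d) a)

majDes : List ℕ → ℕ × ℕ
majDes w = maj w , des w

-- Inserting a new maximum into σ after its first letter: the slot at the end keeps (maj, des),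
-- the des σ descent slots raise maj by 1, …, des σ, and the asc σ ascent slots raise it by
-- des σ + 2, …, des σ + asc σ + 1 while creating a descent.
profile : ℕ → ℕ → ℕ → List (ℕ × ℕ)
profile m d a =
  (m , d) ∷ (map (λ i → (m + i , d)) (interval 1 d) ++ map (λ i → (m + i , suc d)) (interval (2 + d) a))

prependBit : ℕ → ℕ × ℕ → ℕ × ℕ
prependBit e (m , d) = e + d + m , e + d

map-prependBit-profile : ∀ e m d a → map (prependBit e) (profile m d a) ≡
  (e + d + m , e + d) ∷ (map (λ i → (e + d + (m + i) , e + d)) (interval 1 d)
                      ++ map (λ i → (e + suc d + (m + i) , e + suc d)) (interval (2 + d) a))
map-prependBit-profile e m d a = cong ((e + d + m , e + d) ∷_)
  (trans (map-++ (prependBit e) (map (λ i → (m + i , d)) (interval 1 d)) (map (λ i → (m + i , suc d)) (interval (2 + d) a)))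
         (cong₂ _++_ (sym (map-∘ (interval 1 d))) (sym (map-∘ (interval (2 + d) a)))))

prependAscent-profile : ∀ m d a →
  (suc d + suc (d + m) , suc d) ∷ map (prependBit 0) (profile m d a) ↭ profile (d + m) d (suc a)
prependAscent-profile m d a = begin
  F ∷ map (prependBit 0) (profile m d a) ≡⟨ cong (F ∷_) (map-prependBit-profile 0 m d a) ⟩
  F ∷ (d + m , d) ∷ L₁ ++ L₂             ↭⟨ swap F _ ↭-refl ⟩
  (d + m , d) ∷ F ∷ L₁ ++ L₂             ↭⟨ prep _ (↭-sym (shift F L₁ L₂)) ⟩
  (d + m , d) ∷ L₁ ++ F ∷ L₂             ≡⟨ cong ((d + m , d) ∷_) (cong₂ _++_ L₁≡ (cong₂ _∷_ F≡ L₂≡)) ⟩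
  profile (d + m) d (suc a)              ∎
  where
  open PermutationReasoning
  F  = (suc d + suc (d + m) , suc d)
  L₁ = map (λ i → (d + (m + i) , d)) (interval 1 d)
  L₂ = map (λ i → (suc d + (m + i) , suc d)) (interval (2 + d) a)
  L₁≡ : L₁ ≡ map (λ i → (d + m + i , d)) (interval 1 d)
  L₁≡ = map-cong (λ i → cong (_, d) (sym (+-assoc d m i))) (interval 1 d)
  F≡ : F ≡ (d + m + (2 + d) , suc d)
  F≡ = cong (_, suc d) (solve 2 (λ d m → con 1 :+ d :+ (con 1 :+ (d :+ m)) := d :+ m :+ (con 2 :+ d)) refl d m)
  L₂≡ : L₂ ≡ map (λ i → (d + m + i , suc d)) (interval (3 + d) a)
  L₂≡ = trans (map-cong (λ i → cong (_, suc d) (trans (cong suc (sym (+-assoc d m i))) (sym (+-suc (d + m) i))))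
                        (interval (2 + d) a))
              (trans (map-∘ (interval (2 + d) a)) (cong (map _) (sym (interval-suc (2 + d) a))))

prependDescent-profile : ∀ m d a →
  (suc d + suc (d + m) , suc d) ∷ map (prependBit 1) (profile m d a) ↭ profile (suc (d + m)) (suc d) a
prependDescent-profile m d a = begin
  F ∷ map (prependBit 1) (profile m d a) ≡⟨ cong (F ∷_) (map-prependBit-profile 1 m d a) ⟩
  F ∷ (suc (d + m) , suc d) ∷ L₁ ++ L₂   ↭⟨ swap F _ ↭-refl ⟩
  (suc (d + m) , suc d) ∷ F ∷ L₁ ++ L₂   ↭⟨ prep _ (↭-sym (shift F L₁ L₂)) ⟩
  (suc (d + m) , suc d) ∷ L₁ ++ F ∷ L₂   ≡⟨ cong ((suc (d + m) , suc d) ∷_) L₁FL₂≡ ⟩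
  profile (suc (d + m)) (suc d) a        ∎
  where
  open PermutationReasoning
  F  = (suc d + suc (d + m) , suc d)
  f  = λ i → (suc (d + m) + i , suc d)
  L₁ = map (λ i → (1 + d + (m + i) , 1 + d)) (interval 1 d)
  L₂ = map (λ i → (1 + suc d + (m + i) , 1 + suc d)) (interval (2 + d) a)
  L₁≡ : L₁ ≡ map f (interval 1 d)
  L₁≡ = map-cong (λ i → cong (λ k → (suc k , suc d)) (sym (+-assoc d m i))) (interval 1 d)
  F≡ : F ≡ f (1 + d)
  F≡ = cong (_, suc d) (solve 2 (λ d m → con 1 :+ d :+ (con 1 :+ (d :+ m)) := con 1 :+ (d :+ m) :+ (con 1 :+ d)) refl d m)
  L₁F≡ : L₁ ++ [ F ] ≡ map f (interval 1 (suc d))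
  L₁F≡ = trans (cong₂ _++_ L₁≡ (cong [_] F≡))
               (trans (sym (map-++ f (interval 1 d) [ 1 + d ])) (cong (map f) (sym (interval-snoc 1 d))))
  L₂≡ : L₂ ≡ map (λ i → (suc (d + m) + i , suc (suc d))) (interval (3 + d) a)
  L₂≡ = trans (map-cong (λ i → cong (_, suc (suc d))
                 (solve 3 (λ d m i → con 1 :+ (con 1 :+ d) :+ (m :+ i) := con 1 :+ (d :+ m) :+ (con 1 :+ i)) refl d m i))
                 (interval (2 + d) a))
              (trans (map-∘ (interval (2 + d) a)) (cong (map _) (sym (interval-suc (2 + d) a))))
  L₁FL₂≡ : L₁ ++ F ∷ L₂ ≡ map f (interval 1 (suc d)) ++ map (λ i → (suc (d + m) + i , suc (suc d))) (interval (3 + d) a)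
  L₁FL₂≡ = trans (sym (++-assoc L₁ [ F ] L₂)) (cong₂ _++_ L₁F≡ L₂≡)

-- Putting a letter t in front of σ: the old slots now follow one more letter, whose descent bit
-- is e, and the new slot right after t gives the first entry.
prepend-profile : ∀ {a} {A : Set a} m d a (e : Dec A) →
  (suc d + suc (d + m) , suc d) ∷ map (prependBit (𝟙 e)) (profile m d a) ↭ profile (𝟙 e + d + m) (𝟙 e + d) (𝟙 (¬? e) + a)
prepend-profile m d a (yes _) = prependDescent-profile m d a
prepend-profile m d a (no _)  = prependAscent-profile m d a

majDes-insertAfterHead : ∀ M t τ → All (_< M) (t ∷ τ) →
  map (λ q → majDes (insert (suc q) M (t ∷ τ))) (interval 0 (length (t ∷ τ)))
    ↭ profile (maj (t ∷ τ)) (des (t ∷ τ)) (asc (t ∷ τ))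
majDes-insertAfterHead M t []      (t<M ∷ [])               rewrite 𝟙<-asym t<M = ↭-refl
majDes-insertAfterHead M t (u ∷ τ) (t<M ∷ u∷τ<M@(u<M ∷ _)) = begin
  majDes (t ∷ M ∷ u ∷ τ) ∷ map (λ q → majDes (insert (suc q) M (t ∷ u ∷ τ))) (interval 1 n)
    ≡⟨ cong₂ _∷_ head≡ (trans (map-interval-suc _ 0 n) (map-∘ (interval 0 n))) ⟩
  F ∷ map (prependBit (𝟙 (u <? t))) (map (λ q → majDes (insert (suc q) M (u ∷ τ))) (interval 0 n))
    ↭⟨ prep F (map⁺ (prependBit (𝟙 (u <? t))) (majDes-insertAfterHead M u τ u∷τ<M)) ⟩
  F ∷ map (prependBit (𝟙 (u <? t))) (profile (maj (u ∷ τ)) (des (u ∷ τ)) (asc (u ∷ τ)))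
    ↭⟨ prepend-profile (maj (u ∷ τ)) (des (u ∷ τ)) (asc (u ∷ τ)) (u <? t) ⟩
  profile (maj (t ∷ u ∷ τ)) (des (t ∷ u ∷ τ)) (asc (t ∷ u ∷ τ)) ∎
  where
  open PermutationReasoning
  n = suc (length τ)
  F = (suc (des (u ∷ τ)) + suc (des (u ∷ τ) + maj (u ∷ τ)) , suc (des (u ∷ τ)))
  head≡ : majDes (t ∷ M ∷ u ∷ τ) ≡ F
  head≡ rewrite 𝟙<-asym t<M | 𝟙-yes u<M (u <? M) = refl

-- The front slot supplies the missing increase des σ + 1.
maj-shifts : ShiftsUnderMaxInsertion maj
maj-shifts M []      [] = ↭-refl
maj-shifts M (t ∷ τ) σ<M@(t<M ∷ _) = begin
  map (λ p → maj (insert p M σ)) (slots σ)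
    ≡⟨ cong₂ _∷_ front≡ (trans (map-interval-suc _ 0 (length σ)) (map-∘ (interval 0 (length σ)))) ⟩
  suc (d + m) ∷ map proj₁ (map (λ q → majDes (insert (suc q) M σ)) (interval 0 (length σ)))
    ↭⟨ prep _ (map⁺ proj₁ (majDes-insertAfterHead M t τ σ<M)) ⟩
  suc (d + m) ∷ map proj₁ (profile m d a)
    ≡⟨ cong (λ z → suc (d + m) ∷ m ∷ z) rest≡ ⟩
  suc (d + m) ∷ m ∷ A₁ ++ A₂
    ↭⟨ swap _ _ ↭-refl ⟩
  m ∷ suc (d + m) ∷ A₁ ++ A₂
    ↭⟨ prep m (↭-sym (shift _ A₁ A₂)) ⟩
  m ∷ A₁ ++ suc (d + m) ∷ A₂
    ≡⟨ target≡ ⟨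
  map (m +_) (slots σ) ∎
  where
  open PermutationReasoning
  σ = t ∷ τ
  m = maj σ
  d = des σ
  a = asc σ
  A₁ = map (m +_) (interval 1 d)
  A₂ = map (m +_) (interval (2 + d) a)
  front≡ : maj (M ∷ σ) ≡ suc (d + m)
  front≡ rewrite 𝟙-yes t<M (t <? M) = refl
  rest≡ : map proj₁ (map (λ i → (m + i , d)) (interval 1 d) ++ map (λ i → (m + i , suc d)) (interval (2 + d) a)) ≡ A₁ ++ A₂
  rest≡ = trans (map-++ proj₁ (map (λ i → (m + i , d)) (interval 1 d)) (map (λ i → (m + i , suc d)) (interval (2 + d) a)))
                (cong₂ _++_ (sym (map-∘ (interval 1 d))) (sym (map-∘ (interval (2 + d) a))))
  target≡ : map (m +_) (slots σ) ≡ m ∷ A₁ ++ suc (d + m) ∷ A₂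
  target≡ = trans (cong (λ z → map (m +_) (interval 0 (suc z))) (length≡1+des+asc t τ)) (map-+-interval-split m d a)

below-insert : ∀ x q M τ → below x (insert q M τ) ≡ 𝟙 (M <? x) + below x τ
below-insert x zero    M τ       = refl
below-insert x (suc q) M []      = refl
below-insert x (suc q) M (s ∷ τ) rewrite below-insert x q M τ = x∙yz≈y∙xz (𝟙 (s <? x)) (𝟙 (M <? x)) (below x τ)

below-all : ∀ M σ → All (_< M) σ → below M σ ≡ length σ
below-all M []      []         = refl
below-all M (t ∷ σ) (t<M ∷ σ<M) rewrite 𝟙-yes t<M (t <? M) = cong suc (below-all M σ σ<M)

inv-shifts : ShiftsUnderMaxInsertion Word.inv
inv-shifts M []      [] = ↭-refl
inv-shifts M (t ∷ τ) σ<M@(t<M ∷ τ<M) = begin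
  map (λ p → Word.inv (insert p M σ)) (slots σ)
    ≡⟨ cong₂ _∷_ front≡ rest≡ ⟩
  Word.inv σ + c ∷ map (below t τ +_) (map (λ q → Word.inv (insert q M τ)) (slots τ))
    ↭⟨ prep _ (map⁺ (below t τ +_) (inv-shifts M τ τ<M)) ⟩
  Word.inv σ + c ∷ map (below t τ +_) (map (Word.inv τ +_) (slots τ))
    ≡⟨ cong (Word.inv σ + c ∷_) shifted≡ ⟩
  Word.inv σ + c ∷ map (Word.inv σ +_) (interval 0 c)
    ↭⟨ ++-comm [ _ ] _ ⟩
  map (Word.inv σ +_) (interval 0 c) ++ [ Word.inv σ + c ]
    ≡⟨ trans (cong (map (Word.inv σ +_)) (interval-snoc 0 c)) (map-++ (Word.inv σ +_) (interval 0 c) [ c ]) ⟨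
  map (Word.inv σ +_) (slots σ) ∎
  where
  open PermutationReasoning
  σ = t ∷ τ
  c = length σ
  shifted≡ : map (below t τ +_) (map (Word.inv τ +_) (slots τ)) ≡ map (Word.inv σ +_) (interval 0 c)
  shifted≡ = trans (sym (map-∘ (slots τ))) (map-cong (λ i → sym (+-assoc (below t τ) (Word.inv τ) i)) (slots τ))
  front≡ : Word.inv (M ∷ σ) ≡ Word.inv σ + c
  front≡ = trans (cong (_+ Word.inv σ) (below-all M σ σ<M)) (+-comm c (Word.inv σ))
  rest≡ : map (λ p → Word.inv (insert p M σ)) (interval 1 c) ≡ map (below t τ +_) (map (λ q → Word.inv (insert q M τ)) (slots τ))
  rest≡ = trans (map-interval-suc _ 0 c)
                (trans (map-cong (λ q → cong (_+ Word.inv (insert q M τ)) (below-t q)) (slots τ)) (map-∘ (slots τ)))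
    where
    below-t : ∀ q → below t (insert q M τ) ≡ below t τ
    below-t q = trans (below-insert t q M τ) (cong (_+ below t τ) (𝟙<-asym t<M))

-- Arrangements and MacMahon's theorem

module _ {A : Set} where

  picks : List A → List (A × List A)
  picks []       = []
  picks (x ∷ xs) = (x , xs) ∷ map (λ (y , ys) → y , x ∷ ys) (picks xs)

  arrangements : ℕ → List A → List (List A)
  arrangements zero    xs = [] ∷ []
  arrangements (suc k) xs = concatMap (λ (y , ys) → map (y ∷_) (arrangements k ys)) (picks xs)

  ∈-picks⁻ : ∀ x xs {p} → p ∈ picks (x ∷ xs) →
    p ≡ (x , xs) ⊎ ∃ λ q → q ∈ picks xs × p ≡ (proj₁ q , x ∷ proj₂ q)
  ∈-picks⁻ x xs (here p≡)  = inj₁ p≡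
  ∈-picks⁻ x xs (there p∈) = inj₂ (∈-map⁻ _ p∈)

  picks-↭ : ∀ xs {p} → p ∈ picks xs → proj₁ p ∷ proj₂ p ↭ xs
  picks-↭ (x ∷ xs) p∈ with ∈-picks⁻ x xs p∈
  ... | inj₁ refl              = ↭-refl
  ... | inj₂ ((y , ys) , q∈ , refl) = ↭-trans (swap y x ↭-refl) (prep x (picks-↭ xs q∈))

  ∈-picks⁺ : ∀ {x xs} → x ∈ xs → ∃ λ ys → (x , ys) ∈ picks xs
  ∈-picks⁺ {xs = x ∷ xs} (here refl) = xs , here refl
  ∈-picks⁺ {xs = y ∷ xs} (there x∈)  =
    let ys , q∈ = ∈-picks⁺ x∈ in y ∷ ys , there (∈-map⁺ (λ (z , zs) → z , y ∷ zs) q∈)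

  picks-AllPairs : ∀ {ℓ} {R : A → A → Set ℓ} xs {p} → AllPairs R xs → p ∈ picks xs → AllPairs R (proj₂ p)
  picks-AllPairs (x ∷ xs) (x~xs ∷ xs~) p∈ with ∈-picks⁻ x xs p∈
  ... | inj₁ refl              = xs~
  ... | inj₂ ((y , ys) , q∈ , refl) =
    All.tail (All-resp-↭ (↭-sym (picks-↭ xs q∈)) x~xs) ∷ picks-AllPairs xs xs~ q∈

  map-proj₁-picks : ∀ xs → map proj₁ (picks xs) ≡ xs
  map-proj₁-picks []       = refl
  map-proj₁-picks (x ∷ xs) = cong (x ∷_) (trans (sym (map-∘ (picks xs))) (map-proj₁-picks xs))

  ∈-arrangements⁻ : ∀ k xs {w} → w ∈ arrangements (suc k) xs →
    ∃ λ p → p ∈ picks xs × ∃ λ w′ → w′ ∈ arrangements k (proj₂ p) × w ≡ proj₁ p ∷ w′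
  ∈-arrangements⁻ k xs w∈ =
    let p , p∈ , w∈′ = find (∈-concatMap⁻ _ {xs = picks xs} w∈)
        w′ , w′∈ , w≡ = ∈-map⁻ _ w∈′
    in p , p∈ , w′ , w′∈ , w≡

  arrangements-↭ : ∀ k xs {w} → length xs ≡ k → w ∈ arrangements k xs → w ↭ xs
  arrangements-↭ zero    []  _   (here refl) = ↭-refl
  arrangements-↭ (suc k) xs |xs| w∈ with ∈-arrangements⁻ k xs w∈
  ... | (y , ys) , p∈ , w′ , w′∈ , refl =
    ↭-trans (prep y (arrangements-↭ k ys |ys| w′∈)) (picks-↭ xs p∈)
    where |ys| = suc-injective (trans (↭-length (picks-↭ xs p∈)) |xs|)

  ∈-arrangements⁺ : ∀ k xs {w} → length w ≡ k → Unique w → All (_∈ xs) w → w ∈ arrangements k xs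
  ∈-arrangements⁺ zero    xs {[]}    _   _             _            = here refl
  ∈-arrangements⁺ (suc k) xs {x ∷ w} |w| (x∉w ∷ w-uniq) (x∈ ∷ w⊆xs) =
    let ys , p∈ = ∈-picks⁺ x∈
        w⊆ys = All.zipWith (λ (y∈ , x≢y) → ∈-rest p∈ y∈ (x≢y ∘ sym)) (w⊆xs , x∉w)
    in ∈-concatMap⁺ _ (lose p∈ (∈-map⁺ (x ∷_) (∈-arrangements⁺ k ys (suc-injective |w|) w-uniq w⊆ys)))
    where
    ∈-rest : ∀ {ys y} → (x , ys) ∈ picks xs → y ∈ xs → y ≢ x → y ∈ ys
    ∈-rest p∈ y∈ y≢x with ∈-resp-↭ (↭-sym (picks-↭ xs p∈)) y∈
    ... | here y≡x = contradiction y≡x y≢x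
    ... | there y∈ys = y∈ys

  Unique-concatMap-prefix : ∀ (ps : List (A × List A)) (L : A × List A → List (List A)) →
    Unique (map proj₁ ps) → (∀ {p} → p ∈ ps → Unique (L p)) →
    Unique (concatMap (λ p → map (proj₁ p ∷_) (L p)) ps)
  Unique-concatMap-prefix []       L _              _      = []
  Unique-concatMap-prefix (p ∷ ps) L (p∉ps ∷ ps-uniq) L-uniq =
    Unique.++⁺ (Unique.map⁺ ∷-injectiveʳ (L-uniq (here refl)))
               (Unique-concatMap-prefix ps L ps-uniq (L-uniq ∘ there)) disjoint
    where
    disjoint : ∀ {v} → ¬ (v ∈ map (proj₁ p ∷_) (L p) × v ∈ concatMap (λ p → map (proj₁ p ∷_) (L p)) ps)
    disjoint (v∈ , v∈′) with ∈-map⁻ _ v∈ | find (∈-concatMap⁻ _ {xs = ps} v∈′)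
    ... | _ , _ , refl | q , q∈ , v∈″ with ∈-map⁻ _ v∈″
    ... | _ , _ , v≡ = All.lookup p∉ps (∈-map⁺ proj₁ q∈) (∷-injectiveˡ v≡)

  arrangements-Unique : ∀ k xs → Unique xs → Unique (arrangements k xs)
  arrangements-Unique zero    xs _      = [] ∷ []
  arrangements-Unique (suc k) xs xs-uniq =
    Unique-concatMap-prefix (picks xs) (λ (_ , ys) → arrangements k ys)
      (subst Unique (sym (map-proj₁-picks xs)) xs-uniq)
      (λ p∈ → arrangements-Unique k _ (AllPairs.tail (Unique-resp-↭ (↭-sym (picks-↭ xs p∈)) xs-uniq)))

  arrangements-∷ : ∀ k M xs → length xs ≡ k →
    arrangements (suc k) (M ∷ xs) ↭ concatMap (λ σ → map (λ p → insert p M σ) (interval 0 (suc k))) (arrangements k xs)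
  arrangements-∷ zero    M [] _    = ↭-refl
  arrangements-∷ (suc k) M xs |xs| = begin
    arrangements (suc (suc k)) (M ∷ xs)
      ≡⟨ cong (map (M ∷_) I ++_) (concatMap-map F withM (picks xs)) ⟩
    map (M ∷_) I ++ concatMap (F ∘ withM) (picks xs)
      ↭⟨ ++⁺ˡ (map (M ∷_) I) (concatMap-cong-↭ (F ∘ withM) Y (picks xs) step) ⟩
    map (M ∷_) I ++ concatMap Y (picks xs)
      ≡⟨ cong (map (M ∷_) I ++_) G≡Y ⟨
    map (M ∷_) I ++ concatMap G I
      ↭⟨ concatMap-∷-↭ (M ∷_) G I ⟨
    concatMap (λ σ → map (λ p → insert p M σ) (interval 0 (suc (suc k)))) I ∎
    where
    open PermutationReasoning
    U = interval 0 (suc k)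
    I = arrangements (suc k) xs
    F = λ ((y , ys) : A × List A) → map (y ∷_) (arrangements (suc k) ys)
    H = λ ((y , ys) : A × List A) → map (y ∷_) (arrangements k ys)
    withM = λ ((y , ys) : A × List A) → y , M ∷ ys
    G = λ σ → map (λ p → insert p M σ) (interval 1 (suc k))
    Y = λ ((y , ys) : A × List A) → concatMap (λ σ → map (y ∷_) (map (λ q → insert q M σ) U)) (arrangements k ys)
    step : ∀ {p} → p ∈ picks xs → F (withM p) ↭ Y p
    step {y , ys} p∈ =
      ↭-trans (map⁺ (y ∷_) (arrangements-∷ k M ys (suc-injective (trans (↭-length (picks-↭ xs p∈)) |xs|))))
              (↭-reflexive (map-concatMap (y ∷_) (λ σ → map (λ q → insert q M σ) U) (arrangements k ys)))
    G-∷ : ∀ y σ → G (y ∷ σ) ≡ map (y ∷_) (map (λ q → insert q M σ) U)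
    G-∷ y σ = trans (map-interval-suc _ 0 (suc k)) (map-∘ U)
    G≡Y : concatMap G I ≡ concatMap Y (picks xs)
    G≡Y = trans (concatMap-concatMap G H (picks xs))
      (concatMap-cong (λ (y , ys) → trans (concatMap-map G (y ∷_) (arrangements k ys))
                                           (concatMap-cong (G-∷ y) (arrangements k ys))) (picks xs))

shifts⇒map-arrangements-∷ : ∀ {f} → ShiftsUnderMaxInsertion f → ∀ k M xs → length xs ≡ k → All (_< M) xs →
  map f (arrangements (suc k) (M ∷ xs)) ↭ concatMap (λ v → map (v +_) (interval 0 (suc k))) (map f (arrangements k xs))
shifts⇒map-arrangements-∷ {f} f-shifts k M xs |xs| xs<M = begin
  map f (arrangements (suc k) (M ∷ xs))                  ↭⟨ map⁺ f (arrangements-∷ k M xs |xs|) ⟩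
  map f (concatMap (λ σ → map (λ p → insert p M σ) U) A) ≡⟨ map-concatMap f (λ σ → map (λ p → insert p M σ) U) A ⟩
  concatMap (λ σ → map f (map (λ p → insert p M σ) U)) A ↭⟨ concatMap-cong-↭ _ _ A step ⟩
  concatMap (λ σ → map (f σ +_) U) A                     ≡⟨ concatMap-map (λ v → map (v +_) U) f A ⟨
  concatMap (λ v → map (v +_) U) (map f A)               ∎
  where
  open PermutationReasoning
  U = interval 0 (suc k)
  A = arrangements k xs
  step : ∀ {σ} → σ ∈ A → map f (map (λ p → insert p M σ) U) ↭ map (f σ +_) U
  step {σ} σ∈ with σ↭xs ← arrangements-↭ k xs |xs| σ∈ with refl ← trans (↭-length σ↭xs) |xs| =
    ↭-trans (↭-reflexive (sym (map-∘ U))) (f-shifts M σ (All-resp-↭ (↭-sym σ↭xs) xs<M))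

shifts⇒equidistributed : ∀ {f g} → f [] ≡ g [] → ShiftsUnderMaxInsertion f → ShiftsUnderMaxInsertion g →
  ∀ k xs → AllPairs _>_ xs → length xs ≡ k → map f (arrangements k xs) ↭ map g (arrangements k xs)
shifts⇒equidistributed f≡g _ _ zero [] _ _ = ↭-reflexive (cong [_] f≡g)
shifts⇒equidistributed {f} {g} f≡g f-shifts g-shifts (suc k) (M ∷ xs) (xs<M ∷ xs↓) |M∷xs| = begin
  map f (arrangements (suc k) (M ∷ xs))
    ↭⟨ shifts⇒map-arrangements-∷ f-shifts k M xs |xs| xs<M ⟩
  concatMap raise (map f (arrangements k xs))
    ↭⟨ concatMap⁺ raise (shifts⇒equidistributed f≡g f-shifts g-shifts k xs xs↓ |xs|) ⟩
  concatMap raise (map g (arrangements k xs))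
    ↭⟨ shifts⇒map-arrangements-∷ g-shifts k M xs |xs| xs<M ⟨
  map g (arrangements (suc k) (M ∷ xs)) ∎
  where
  open PermutationReasoning
  |xs| = suc-injective |M∷xs|
  raise = λ v → map (v +_) (interval 0 (suc k))

below-↭ : ∀ x {w r} → w ↭ r → below x w ≡ below x r
below-↭ x ↭-refl        = refl
below-↭ x (prep y p)    = cong (𝟙 (y <? x) +_) (below-↭ x p)
below-↭ x (swap y z p)  =
  trans (cong (λ n → 𝟙 (y <? x) + (𝟙 (z <? x) + n)) (below-↭ x p)) (x∙yz≈y∙xz (𝟙 (y <? x)) (𝟙 (z <? x)) _)
below-↭ x (↭-trans p q) = trans (below-↭ x p) (below-↭ x q)

arrangements-stat↭inv : ∀ k xs → AllPairs _>_ xs → length xs ≡ k →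
  map Word.stat (arrangements k xs) ↭ map Word.inv (arrangements k xs)
arrangements-stat↭inv zero    xs _   _    = ↭-refl
arrangements-stat↭inv (suc k) xs xs↓ |xs| = begin
  map Word.stat (concatMap H (picks xs))       ≡⟨ map-concatMap Word.stat H (picks xs) ⟩
  concatMap (map Word.stat ∘ H) (picks xs)     ↭⟨ concatMap-cong-↭ _ _ (picks xs) step ⟩
  concatMap (map Word.inv ∘ H) (picks xs)      ≡⟨ map-concatMap Word.inv H (picks xs) ⟨
  map Word.inv (concatMap H (picks xs))        ∎
  where
  open PermutationReasoning
  H = λ ((y , ys) : ℕ × List ℕ) → map (y ∷_) (arrangements k ys)
  step : ∀ {p} → p ∈ picks xs → map Word.stat (H p) ↭ map Word.inv (H p)
  step {y , ys} p∈ = begin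
    map Word.stat (H (y , ys))                               ≡⟨ map-∘ A ⟨
    map (λ w → below y w + maj w) A                          ≡⟨ map-cong-∈ _ _ A (cong (_+ _) ∘ below-y) ⟩
    map (λ w → below y ys + maj w) A                         ≡⟨ map-∘ A ⟩
    map (below y ys +_) (map maj A)                          ↭⟨ map⁺ (below y ys +_) maj↭inv ⟩
    map (below y ys +_) (map Word.inv A)                     ≡⟨ map-∘ A ⟨
    map (λ w → below y ys + Word.inv w) A                    ≡⟨ map-cong-∈ _ _ A (cong (_+ _) ∘ below-y) ⟨
    map (λ w → below y w + Word.inv w) A                     ≡⟨ map-∘ A ⟩
    map Word.inv (H (y , ys))                                ∎
    where
    A = arrangements k ys
    |ys| = suc-injective (trans (↭-length (picks-↭ xs p∈)) |xs|)
    below-y : ∀ {w} → w ∈ A → below y w ≡ below y ys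
    below-y w∈ = below-↭ y (arrangements-↭ k ys |ys| w∈)
    maj↭inv : map maj A ↭ map Word.inv A
    maj↭inv = shifts⇒equidistributed refl maj-shifts inv-shifts k ys (picks-AllPairs xs xs↓ p∈) |ys|

-- The vincular statistic on permutations

open import Defs

∑ : ℕ → (ℕ → ℕ) → ℕ
∑ zero    f = 0
∑ (suc n) f = f 0 + ∑ n (λ i → f (suc i))

syntax ∑ n (λ i → e) = ∑[ i < n ] e

∑-cong : ∀ n {f g : ℕ → ℕ} → (∀ i → i < n → f i ≡ g i) → ∑ n f ≡ ∑ n g
∑-cong zero    f≡g = refl
∑-cong (suc n) f≡g = cong₂ _+_ (f≡g 0 (s≤s z≤n)) (∑-cong n (λ i i<n → f≡g (suc i) (s≤s i<n)))

∑-+ : ∀ n (f g : ℕ → ℕ) → ∑ n f + ∑ n g ≡ ∑[ i < n ] (f i + g i)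
∑-+ zero    f g = refl
∑-+ (suc n) f g = trans (interchange (f 0) (∑ n _) (g 0) (∑ n _)) (cong (f 0 + g 0 +_) (∑-+ n _ _))

∑-+₃ : ∀ n (f g h : ℕ → ℕ) → ∑ n f + ∑ n g + ∑ n h ≡ ∑[ i < n ] (f i + g i + h i)
∑-+₃ n f g h = trans (cong (_+ ∑ n h) (∑-+ n f g)) (∑-+ n _ h)

length-filter-applyUpTo : ∀ {A : Set} {p} {P : A → Set p} (P? : Decidable P) (f : ℕ → A) n →
  length (filter P? (applyUpTo f n)) ≡ ∑[ j < n ] 𝟙 (P? (f j))
length-filter-applyUpTo P? f zero    = refl
length-filter-applyUpTo P? f (suc n) =
  trans (length-filter-∷ P? (f 0) _) (cong (𝟙 (P? (f 0)) +_) (length-filter-applyUpTo P? (f ∘ suc) n))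

length-filter-upTo : ∀ {p} {P : ℕ → Set p} (P? : Decidable P) n → length (filter P? (upTo n)) ≡ ∑[ j < n ] 𝟙 (P? j)
length-filter-upTo P? = length-filter-applyUpTo P? id

length-filter-natPairs : ∀ {p} {P : ℕ × ℕ → Set p} (P? : Decidable P) n →
  length (filter P? (natPairs n)) ≡ ∑[ i < n ] ∑[ j < n ] 𝟙 (P? (i , j))
length-filter-natPairs P? n = rows id n
  where
  rows : ∀ (f : ℕ → ℕ) m → length (filter P? (cartesianProduct (applyUpTo f m) (upTo n))) ≡ ∑[ i < m ] ∑[ j < n ] 𝟙 (P? (f i , j))
  rows f zero    = refl
  rows f (suc m) = trans (length-filter-++ P? (map (f 0 ,_) (upTo n)) _)
    (cong₂ _+_ (trans (length-filter-map P? (f 0 ,_) (upTo n)) (length-filter-upTo _ n)) (rows (f ∘ suc) m))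

word : ∀ {m n} → Vec (Fin m) n → List ℕ
word v = map toℕ (toList v)

∑-below : ∀ {m n} (π : Vec (Fin m) n) c → ∑[ j < n ] 𝟙 (at π j <? c) ≡ below c (word π)
∑-below []      c = refl
∑-below (x ∷ π) c = cong (𝟙 (toℕ x <? c) +_) (∑-below π c)

∑∑-inv : ∀ {m n} (π : Vec (Fin m) n) → ∑[ i < n ] ∑[ j < n ] 𝟙 ((i <? j) ×-dec (at π j <? at π i)) ≡ Word.inv (word π)
∑∑-inv []      = refl
∑∑-inv (x ∷ π) = cong₂ _+_ (∑-below π (toℕ x)) (∑∑-inv π)

descentAt? : ∀ {m n} (π : Vec (Fin m) n) j → Dec (suc j < n × at π (suc j) < at π j)
descentAt? {n = n} π j = (suc j <? n) ×-dec (at π (suc j) <? at π j)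

∑-descentAt : ∀ {m n} (π : Vec (Fin m) n) → ∑[ j < n ] 𝟙 (descentAt? π j) ≡ des (word π)
∑-descentAt []          = refl
∑-descentAt (x ∷ [])    = refl
∑-descentAt (x ∷ y ∷ π) = cong (𝟙 (toℕ y <? toℕ x) +_) (∑-descentAt (y ∷ π))

∑∑-descentAt : ∀ {m n} x (π : Vec (Fin m) n) →
  ∑[ i < suc n ] ∑[ j < suc n ] 𝟙 ((i <? j) ×-dec descentAt? (x ∷ π) j) ≡ maj (word π)
∑∑-descentAt x []      = refl
∑∑-descentAt x (y ∷ π) = cong₂ _+_ (∑-descentAt (y ∷ π)) (∑∑-descentAt y π)

ba[≡below : ∀ {n} x (π : Vec (Fin (suc n)) n) → ba[ (x ∷ π) ≡ below (toℕ x) (word π)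
ba[≡below {n} x π =
  trans (length-filter-upTo (λ j → (0 <? j) ×-dec (at (x ∷ π) j <? at (x ∷ π) 0)) (suc n)) (∑-below π (toℕ x))

inv≡Word-inv : ∀ {n} (π : Vec (Fin n) n) → inv π ≡ Word.inv (word π)
inv≡Word-inv {n} π = trans (length-filter-natPairs _ n) (∑∑-inv π)

𝟙-descent-split-≮ : ∀ x y z → ¬ z < y →
  𝟙 ((x <? z) ×-dec (z <? y)) + 𝟙 ((z <? x) ×-dec (x <? y)) + 𝟙 ((z <? y) ×-dec (y <? x)) ≡ 𝟙 (z <? y)
𝟙-descent-split-≮ x y z z≮y
  rewrite 𝟙-no (z≮y ∘ proj₂) ((x <? z) ×-dec (z <? y))
        | 𝟙-no (λ (z<x , x<y) → z≮y (<-trans z<x x<y)) ((z <? x) ×-dec (x <? y))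
        | 𝟙-no (z≮y ∘ proj₁) ((z <? y) ×-dec (y <? x))
        | 𝟙-no z≮y (z <? y) = refl

-- Given a descent z < y, a third distinct value x lies below z, between them, or above y.
𝟙-descent-split : ∀ x y z → x ≢ y → x ≢ z →
  𝟙 ((x <? z) ×-dec (z <? y)) + 𝟙 ((z <? x) ×-dec (x <? y)) + 𝟙 ((z <? y) ×-dec (y <? x)) ≡ 𝟙 (z <? y)
𝟙-descent-split x y z x≢y x≢z with <-cmp z y
... | tri≈ z≮y _ _ = 𝟙-descent-split-≮ x y z z≮y
... | tri> z≮y _ _ = 𝟙-descent-split-≮ x y z z≮y
... | tri< z<y _ _ with <-cmp x z
...   | tri≈ _ x≡z _ = contradiction x≡z x≢z
...   | tri< x<z _ _
  rewrite 𝟙-yes (x<z , z<y) ((x <? z) ×-dec (z <? y))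
        | 𝟙-no (λ (z<x , _) → <-asym x<z z<x) ((z <? x) ×-dec (x <? y))
        | 𝟙-no (λ (_ , y<x) → <-asym (<-trans x<z z<y) y<x) ((z <? y) ×-dec (y <? x))
        | 𝟙-yes z<y (z <? y) = refl
...   | tri> x≮z _ z<x
  rewrite 𝟙-no (x≮z ∘ proj₁) ((x <? z) ×-dec (z <? y))
        | 𝟙-×-yes z<x (z <? x) (x <? y)
        | 𝟙-×-yes z<y (z <? y) (y <? x)
        | 𝟙-yes z<y (z <? y) = 𝟙-<-total x y x≢y

at-∈ : ∀ {m n} (π : Vec (Fin m) n) {j} → j < n → ∃ λ y → y ∈ toList π × at π j ≡ toℕ y
at-∈ (x ∷ π) {zero}  _         = x , here refl , refl
at-∈ (x ∷ π) {suc j} (s≤s j<n) = let y , y∈ , at≡ = at-∈ π j<n in y , there y∈ , at≡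

at-distinct : ∀ {m n} (π : Vec (Fin m) n) → Unique (toList π) → ∀ {i j} → i < n → j < n → i ≢ j → at π i ≢ at π j
at-distinct (x ∷ π) _              {zero}  {zero}  _         _         i≢j _ = i≢j refl
at-distinct (x ∷ π) (x∉π ∷ _)      {zero}  {suc j} _         (s≤s j<n) _   at≡ =
  let y , y∈ , at≡y = at-∈ π j<n in All.lookup x∉π y∈ (toℕ-injective (trans at≡ at≡y))
at-distinct (x ∷ π) (x∉π ∷ _)      {suc i} {zero}  (s≤s i<n) _         _   at≡ =
  let y , y∈ , at≡y = at-∈ π i<n in All.lookup x∉π y∈ (toℕ-injective (trans (sym at≡) at≡y))
at-distinct (x ∷ π) (_ ∷ π-uniq)   {suc i} {suc j} (s≤s i<n) (s≤s j<n) i≢j =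
  at-distinct π π-uniq i<n j<n (i≢j ∘ cong suc)

module _ {n} (π : Vec (Fin n) n) where

  private
    X = at π

    a-cb : ∀ i j → Dec (X i < X (suc j) × X (suc j) < X j)
    a-cb i j = (X i <? X (suc j)) ×-dec (X (suc j) <? X j)

    b-ca : ∀ i j → Dec (X (suc j) < X i × X i < X j)
    b-ca i j = (X (suc j) <? X i) ×-dec (X i <? X j)

    c-ba : ∀ i j → Dec (X (suc j) < X j × X j < X i)
    c-ba i j = (X (suc j) <? X j) ×-dec (X j <? X i)


    occurrence : ∀ {P : ℕ → ℕ → Set} → (∀ i j → Dec (P i j)) → ℕ → ℕ → ℕ
    occurrence p? i j = 𝟙 ((i <? j) ×-dec ((suc j <? n) ×-dec p? i j))

  acb≡∑∑ : acb π ≡ ∑[ i < n ] ∑[ j < n ] occurrence a-cb i j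
  acb≡∑∑ = length-filter-natPairs _ n

  bca≡∑∑ : bca π ≡ ∑[ i < n ] ∑[ j < n ] occurrence b-ca i j
  bca≡∑∑ = length-filter-natPairs _ n

  cba≡∑∑ : cba π ≡ ∑[ i < n ] ∑[ j < n ] occurrence c-ba i j
  cba≡∑∑ = length-filter-natPairs _ n

  occurrences≡descentAt : IsPerm π → ∀ i j →
    occurrence a-cb i j + occurrence b-ca i j + occurrence c-ba i j ≡ 𝟙 ((i <? j) ×-dec descentAt? π j)
  occurrences≡descentAt π-uniq i j =
    𝟙-×-guard (i <? j) (guarded a-cb) (guarded b-ca) (guarded c-ba) (descentAt? π j) λ i<j →
    𝟙-×-guard (suc j <? n) (a-cb i j) (b-ca i j) (c-ba i j) (X (suc j) <? X j) λ j+1<n →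
    let j<n = <-trans (n<1+n j) j+1<n
        i<n = <-trans i<j j<n
    in 𝟙-descent-split (X i) (X j) (X (suc j))
         (at-distinct π π-uniq i<n j<n (<⇒≢ i<j))
         (at-distinct π π-uniq i<n j+1<n (<⇒≢ (<-trans i<j (n<1+n j))))
    where
    guarded : ∀ {P : ℕ → ℕ → Set} → (∀ i j → Dec (P i j)) → Dec (suc j < n × P i j)
    guarded p? = (suc j <? n) ×-dec p? i j

  acb+bca+cba≡∑∑descentAt : IsPerm π → acb π + bca π + cba π ≡ ∑[ i < n ] ∑[ j < n ] 𝟙 ((i <? j) ×-dec descentAt? π j)
  acb+bca+cba≡∑∑descentAt π-uniq = begin
    acb π + bca π + cba π
      ≡⟨ cong₂ _+_ (cong₂ _+_ acb≡∑∑ bca≡∑∑) cba≡∑∑ ⟩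
    ∑ n (λ i → ∑ n (A i)) + ∑ n (λ i → ∑ n (B i)) + ∑ n (λ i → ∑ n (C i))
      ≡⟨ ∑-+₃ n (λ i → ∑ n (A i)) (λ i → ∑ n (B i)) (λ i → ∑ n (C i)) ⟩
    ∑[ i < n ] (∑ n (A i) + ∑ n (B i) + ∑ n (C i))
      ≡⟨ ∑-cong n (λ i _ → trans (∑-+₃ n (A i) (B i) (C i)) (∑-cong n (λ j _ → occurrences≡descentAt π-uniq i j))) ⟩
    ∑[ i < n ] ∑[ j < n ] 𝟙 ((i <? j) ×-dec descentAt? π j) ∎
    where
    open ≡-Reasoning
    A = occurrence a-cb
    B = occurrence b-ca
    C = occurrence c-ba

stat≡Word-stat : ∀ {n} (π : Vec (Fin n) n) → IsPerm π → stat π ≡ Word.stat (word π)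
stat≡Word-stat []      _      = refl
stat≡Word-stat (x ∷ π) π-uniq = begin
  acb (x ∷ π) + bca (x ∷ π) + cba (x ∷ π) + ba[ (x ∷ π)
    ≡⟨ cong₂ _+_ (trans (acb+bca+cba≡∑∑descentAt (x ∷ π) π-uniq) (∑∑-descentAt x π)) (ba[≡below x π) ⟩
  maj (word π) + below (toℕ x) (word π)
    ≡⟨ +-comm (maj (word π)) _ ⟩
  Word.stat (word (x ∷ π)) ∎
  where open ≡-Reasoning

word-injective : ∀ {m n} {u v : Vec (Fin m) n} → word u ≡ word v → u ≡ v
word-injective {u = u} {v} w≡ = trans (sym (cast-is-id refl u)) (toList-injective refl u v (map-injective toℕ-injective w≡))

length-word : ∀ {m n} (v : Vec (Fin m) n) → length (word v) ≡ n
length-word v = trans (length-map toℕ (toList v)) (length-toList v)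

word-< : ∀ {m n} (v : Vec (Fin m) n) → All (_< m) (word v)
word-< v = All.map⁺ (All.universal toℕ<n (toList v))

fromWord : ∀ {m} w → All (_< m) w → Vec (Fin m) (length w)
fromWord []      []          = []
fromWord (x ∷ w) (x<m ∷ w<m) = fromℕ< x<m ∷ fromWord w w<m

word-fromWord : ∀ {m} w (w<m : All (_< m) w) → word (fromWord w w<m) ≡ w
word-fromWord []      []          = refl
word-fromWord (x ∷ w) (x<m ∷ w<m) = cong₂ _∷_ (toℕ-fromℕ< x<m) (word-fromWord w w<m)

concatMap-map≡cartesianProductWith : ∀ {A B C : Set} (g : A → B → C) xs ys →
  concatMap (λ x → map (g x) ys) xs ≡ cartesianProductWith g xs ys
concatMap-map≡cartesianProductWith g []       ys = refl
concatMap-map≡cartesianProductWith g (x ∷ xs) ys = cong (map (g x) ys ++_) (concatMap-map≡cartesianProductWith g xs ys)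

words-Unique : ∀ m len → Unique (words m len)
words-Unique m zero      = [] ∷ []
words-Unique m (suc len) = subst Unique (sym (concatMap-map≡cartesianProductWith _∷_ (allFin m) (words m len)))
  (Unique.cartesianProductWith⁺ _∷_ ∷-injective (Unique.allFin⁺ m) (words-Unique m len))

∈-words : ∀ {m len} (v : Vec (Fin m) len) → v ∈ words m len
∈-words []      = here refl
∈-words (x ∷ v) = ∈-concatMap⁺ _ (lose (∈-allFin x) (∈-map⁺ (x ∷_) (∈-words v)))

perms : (n : ℕ) → List (Vec (Fin n) n)
perms n = filter isPerm? (words n n)

map-word-perms↭arrangements : ∀ n → map word (perms n) ↭ arrangements n (downFrom n)
map-word-perms↭arrangements n = ∼bag⇒↭ (unique∧set⇒bag
  (Unique.map⁺ word-injective (Unique.filter⁺ isPerm? (words-Unique n n)))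
  (arrangements-Unique n (downFrom n) (Unique.downFrom⁺ n))
  (mk⇔ to from))
  where
  to : ∀ {w} → w ∈ map word (perms n) → w ∈ arrangements n (downFrom n)
  to w∈ with v , v∈ , refl ← ∈-map⁻ word w∈ with _ , v-perm ← ∈-filter⁻ isPerm? {xs = words n n} v∈ =
    ∈-arrangements⁺ n _ (length-word v) (Unique.map⁺ toℕ-injective v-perm) (All.map ∈-downFrom⁺ (word-< v))
  word-∈ : ∀ w → All (_< length w) w → Unique w → w ∈ map word (perms (length w))
  word-∈ w w<n w-uniq = subst (_∈ map word (perms (length w))) (word-fromWord w w<n)
    (∈-map⁺ word (∈-filter⁺ isPerm? (∈-words v) (Unique.map⁻ (subst Unique (sym (word-fromWord w w<n)) w-uniq))))
    where v = fromWord w w<n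
  from : ∀ {w} → w ∈ arrangements n (downFrom n) → w ∈ map word (perms n)
  from {w} w∈ with w↭ ← arrangements-↭ n (downFrom n) (length-downFrom n) w∈
              with refl ← trans (↭-length w↭) (length-downFrom n) =
    word-∈ w (All-resp-↭ (↭-sym w↭) (All.tabulate ∈-downFrom⁻)) (Unique-resp-↭ (↭-sym w↭) (Unique.downFrom⁺ (length w)))

downFrom-decreasing : ∀ n → AllPairs _>_ (downFrom n)
downFrom-decreasing n = applyDownFrom⁺₁ id n (λ j<i _ → j<i)

perms-stat↭inv : ∀ n → map stat (perms n) ↭ map inv (perms n)
perms-stat↭inv n = begin
  map stat (perms n)                          ≡⟨ map-cong-∈ _ _ (perms n) (λ π∈ → stat≡Word-stat _ (isPerm π∈)) ⟩
  map (Word.stat ∘ word) (perms n)            ≡⟨ map-∘ (perms n) ⟩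
  map Word.stat (map word (perms n))          ↭⟨ map⁺ Word.stat (map-word-perms↭arrangements n) ⟩
  map Word.stat (arrangements n (downFrom n)) ↭⟨ arrangements-stat↭inv n _ (downFrom-decreasing n) (length-downFrom n) ⟩
  map Word.inv (arrangements n (downFrom n))  ↭⟨ map⁺ Word.inv (map-word-perms↭arrangements n) ⟨
  map Word.inv (map word (perms n))           ≡⟨ map-∘ (perms n) ⟨
  map (Word.inv ∘ word) (perms n)             ≡⟨ map-cong-∈ _ _ (perms n) (λ {π} _ → inv≡Word-inv π) ⟨
  map inv (perms n)                           ∎
  where
  open PermutationReasoning
  isPerm : ∀ {π} → π ∈ perms n → IsPerm π
  isPerm π∈ = proj₂ (∈-filter⁻ isPerm? {xs = words n n} π∈)

count≡length-filter : ∀ n f k → count n f k ≡ length (filter (λ v → ℤ.+ v ℤ.≟ k) (map f (perms n)))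
count≡length-filter n f k =
  trans (cong length (filter-×-dec isPerm? (λ π → ℤ.+ f π ℤ.≟ k) (words n n)))
        (sym (length-filter-map (λ v → ℤ.+ v ℤ.≟ k) f (perms n)))

theorem2 : (n : ℕ) → n ≥ 1 → (k : ℤ) → count n stat k ≡ count n inv k
theorem2 n _ k = begin
  count n stat k                                             ≡⟨ count≡length-filter n stat k ⟩
  length (filter (λ v → ℤ.+ v ℤ.≟ k) (map stat (perms n)))   ≡⟨ ↭-length (filter-↭ _ (perms-stat↭inv n)) ⟩
  length (filter (λ v → ℤ.+ v ℤ.≟ k) (map inv (perms n)))    ≡⟨ count≡length-filter n inv k ⟨
  count n inv k                                              ∎
  where open ≡-Reasoning
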